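{- Let $p$ be a program of the split fireball calculus and let $\pi \triangleright \Gamma \vdash p : \mathbf 0$ be a tight type derivation. Then there is a normalising evaluation $d : p \to_{\beta_f}^* q$ (with $q$ normal) such that $|\pi| = |d| + |q| = |d| + |\Gamma|$. In particular, if $\mathrm{dom}(\Gamma)=\emptyset$, then $|\pi| = |d|$ and $q$ is a coerced value.
   Context: Terms: $t,u ::= x \mid \lambda x.t \mid tu$, up to $\alpha$-equivalence; $t\{x\leftarrow u\}$ is capture-avoiding substitution. Values: $v ::= x \mid \lambda x.t$. Fireballs $f$ and inert terms $i$ are defined by mutual induction: $f ::= v \mid i$ and $i ::= x f_1 \dots f_n$ with $n>0$ (application left-associative). Right evaluation contexts: $C ::= \langle\cdot\rangle \mid t\,C \mid C\,f$. Split fireball calculus: environments $E ::= \epsilon \mid [x\leftarrow i]:E$; programs are pairs $p=(t,E)$; a coerced value is a program $(v,\epsilon)$. Reduction: $(C\langle(\lambda x.t)v\rangle,E)\to_{\beta_v}(C\langle t\{x\leftarrow v\}\rangle,E)$ and $(C\langle(\lambda x.t)i\rangle,E)\to_{\beta_i}(C\langle t\rangle,[x\leftarrow i]:E)$; $\to_{\beta_f}=\to_{\beta_v}\cup\to_{\beta_i}$. A program is normal if it has no $\to_{\beta_f}$-reduct. $|d|$ is the number of steps of an evaluation $d$. Append: $\epsilon@[x\leftarrow i]=[x\leftarrow i]$, $([y\leftarrow i']:E)@[x\leftarrow i]=[y\leftarrow i']:(E@[x\leftarrow i])$. Sizes: $|v|=0$, $|tu|=|t|+|u|+1$, $|(t,\epsilon)|=|t|$,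 $|(t,E@[x\leftarrow i])|=|(t,E)|+|i|$. Multi types: linear types $L ::= M\multimap N$; multi types $M,N ::= [L_1,\dots,L_n]$ (finite multisets, $n\ge 0$); $\mathbf 0$ is the empty multiset, $\uplus$ multiset sum. Type context $\Gamma$: total map from variables to multi types with finite $\mathrm{dom}(\Gamma)=\{x\mid \Gamma(x)\ne\mathbf 0\}$; $(\Gamma\uplus\Delta)(x)=\Gamma(x)\uplus\Delta(x)$; $x:M$ maps $x$ to $M$ and all else to $\mathbf 0$; $\Gamma,x:M$ extends $\Gamma$ ($x\notin\mathrm{dom}(\Gamma)$) by $x\mapsto M$. Typing rules: (ax) $x:M\vdash x:M$; (@) from $\Gamma\vdash t:[M\multimap N]$ and $\Delta\vdash u:M$ infer $\Gamma\uplus\Delta\vdash tu:N$; ($\lambda$) from $\Gamma_k,x:M_k\vdash t:N_k$ for $k=1,\dots,n$ ($n\ge0$) infer $\Gamma_1\uplus\dots\uplus\Gamma_n\vdash\lambda x.t:[M_1\multimap N_1,\dots,M_n\multimap N_n]$; (es$_\epsilon$) from $\Gamma\vdash t:M$ infer $\Gamma\vdash (t,\epsilon):M$; (es$_@$) from $\Gamma,x:M\vdash(t,E):N$ and $\Delta\vdash i:M$ infer $\Gamma\uplus\Delta\vdash(t,E@[x\leftarrow i]):N$. $|\pi|$ is the number of (@) rules in $\pi$. Type sizes: $|M\multimap N|=1+|M|+|N|$, $|[L_1,\dots,L_n]|=\sum_k|L_k|$, and for a context $|\Gamma|=\sum_x|\Gamma(x)|$. Inert multi types are defined inductively as finite multisets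 of linear types of the form $\mathbf 0\multimap N$ with $N$ inert (so $\mathbf 0$ is inert); a context is inert if all its values are inert. A derivation $\pi\triangleright\Gamma\vdash e:M$ is inert if $\Gamma$ and $M$ are inert, and tight if it is inert and $M=\mathbf 0$. -}

module Defs where

open import Data.Nat using (ℕ; zero; suc; _+_)
open import Data.Fin using (Fin; zero; suc)
open import Data.List using (List; []; _∷_; _++_)
open import Data.Vec using (Vec; []; _∷_; zipWith; replicate)
open import Data.Vec.Relation.Unary.All using (All)
open import Data.Product using (Σ; _×_; _,_)
open import Relation.Binary.PropositionalEquality using (_≡_)
open import Relation.Nullary using (¬_)

-- Terms, up to α-equivalence: well-scoped de Bruijn terms.
-- Tm n = terms whose free variables are among n variables
-- (index zero = most recently bound variable).

data Tm (n : ℕ) : Set where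
  var : Fin n → Tm n
  lam : Tm (suc n) → Tm n
  app : Tm n → Tm n → Tm n

ext : ∀ {n m} → (Fin n → Fin m) → Fin (suc n) → Fin (suc m)
ext ρ zero    = zero
ext ρ (suc x) = suc (ρ x)

rename : ∀ {n m} → (Fin n → Fin m) → Tm n → Tm m
rename ρ (var x)   = var (ρ x)
rename ρ (lam t)   = lam (rename (ext ρ) t)
rename ρ (app t u) = app (rename ρ t) (rename ρ u)

wk : ∀ {n} → Tm n → Tm (suc n)
wk = rename suc

exts : ∀ {n m} → (Fin n → Tm m) → Fin (suc n) → Tm (suc m)
exts σ zero    = var zero
exts σ (suc x) = wk (σ x)

subst : ∀ {n m} → (Fin n → Tm m) → Tm n → Tm m
subst σ (var x)   = σ x
subst σ (lam t)   = lam (subst (exts σ) t)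
subst σ (app t u) = app (subst σ t) (subst σ u)

-- t{x←u}, where x is the variable bound by the λ (index zero)
_[_] : ∀ {n} → Tm (suc n) → Tm n → Tm n
t [ u ] = subst σ t
  where
  σ : Fin (suc _) → Tm _
  σ zero    = u
  σ (suc x) = var x

data IsVal {n : ℕ} : Tm n → Set where
  var : (x : Fin n) → IsVal (var x)
  lam : (t : Tm (suc n)) → IsVal (lam t)

mutual
  data IsFire {n : ℕ} : Tm n → Set where
    val   : ∀ {v} → IsVal v → IsFire v
    inert : ∀ {i} → IsInert i → IsFire i

  -- i ::= x f₁ … fₖ  (k > 0), application left-associative
  data IsInert {n : ℕ} : Tm n → Set where
    varApp : ∀ (x : Fin n) {f} → IsFire f → IsInert (app (var x) f)
    inApp  : ∀ {i f} → IsInert i → IsFire f → IsInert (app i f)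

Inert : ℕ → Set
Inert n = Σ (Tm n) IsInert

-- Right evaluation contexts  C ::= ⟨·⟩ | t C | C f

data ECtx (n : ℕ) : Set where
  hole   : ECtx n
  argCtx : Tm n → ECtx n → ECtx n
  funCtx : ECtx n → Tm n → ECtx n

data RightCtx {n : ℕ} : ECtx n → Set where
  hole   : RightCtx hole
  argCtx : ∀ t {C} → RightCtx C → RightCtx (argCtx t C)
  funCtx : ∀ {C f} → RightCtx C → IsFire f → RightCtx (funCtx C f)

plug : ∀ {n} → ECtx n → Tm n → Tm n
plug hole         s = s
plug (argCtx t C) s = app t (plug C s)
plug (funCtx C f) s = app (plug C s) f

-- weakening of a context (the bound variable of the fired λ is fresh for C)
wkC : ∀ {n} → ECtx n → ECtx (suc n)
wkC hole         = hole
wkC (argCtx t C) = argCtx (wk t) (wkC C)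
wkC (funCtx C f) = funCtx (wkC C) (wk f)

-- Env n m : an environment [x₁←i₁]:…:[xₖ←iₖ]:ε (m = n + k) closing a term
-- of scope m down to scope n.  The head entry is innermost: i₁ lives in
-- the scope of the remaining entries, and x₁ is de Bruijn index zero.

data Env (n : ℕ) : ℕ → Set where
  ε   : Env n n
  _∷_ : ∀ {m} → Inert m → Env n m → Env n (suc m)

-- append  E@[x←i]  (x is the outermost bound variable, index zero of suc n)
_∷ʳ_ : ∀ {n m} → Env (suc n) m → Inert n → Env n m
ε        ∷ʳ i = i ∷ ε
(j ∷ E) ∷ʳ i = j ∷ (E ∷ʳ i)

record Prog (n : ℕ) : Set where
  constructor ⟨_,_⟩
  field
    {m} : ℕ
    tm  : Tm m
    env : Env n m

data _⟶_ {n : ℕ} : Prog n → Prog n → Set where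
  βv : ∀ {m} (C : ECtx m) → RightCtx C → (t : Tm (suc m)) {v : Tm m} → IsVal v →
       (E : Env n m) →
       ⟨ plug C (app (lam t) v) , E ⟩ ⟶ ⟨ plug C (t [ v ]) , E ⟩
  βi : ∀ {m} (C : ECtx m) → RightCtx C → (t : Tm (suc m)) {i : Tm m} (ii : IsInert i) →
       (E : Env n m) →
       ⟨ plug C (app (lam t) i) , E ⟩ ⟶ ⟨ plug (wkC C) t , (i , ii) ∷ E ⟩

data _⟶*[_]_ {n : ℕ} : Prog n → ℕ → Prog n → Set where
  done : ∀ {p} → p ⟶*[ 0 ] p
  step : ∀ {p q r k} → p ⟶ q → q ⟶*[ k ] r → p ⟶*[ suc k ] r

Normal : ∀ {n} → Prog n → Set
Normal p = ∀ q → ¬ (p ⟶ q)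

data CoercedValue {n : ℕ} : Prog n → Set where
  coerced : ∀ {v : Tm n} → IsVal v → CoercedValue ⟨ v , ε ⟩

size : ∀ {n} → Tm n → ℕ
size (var x)   = 0
size (lam t)   = 0
size (app t u) = size t + size u + 1

sizeEnv : ∀ {n m} → Env n m → ℕ
sizeEnv ε             = 0
sizeEnv ((i , _) ∷ E) = size i + sizeEnv E

sizeP : ∀ {n} → Prog n → ℕ
sizeP ⟨ t , E ⟩ = size t + sizeEnv E

-- Multi types: multisets represented as lists, compared up to
-- (deep) permutation via _≈ₘ_.

data Lin : Set where
  _⊸_ : List Lin → List Lin → Lin

MType : Set
MType = List Lin

𝟎 : MType
𝟎 = []

mutual
  data _≈ₗ_ : Lin → Lin → Set where
    ⊸-cong : ∀ {M M' N N'} → M ≈ₘ M' → N ≈ₘ N' → (M ⊸ N) ≈ₗ (M' ⊸ N')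

  data _≈ₘ_ : MType → MType → Set where
    []    : [] ≈ₘ []
    _∷_   : ∀ {L L' M M'} → L ≈ₗ L' → M ≈ₘ M' → (L ∷ M) ≈ₘ (L' ∷ M')
    swap  : ∀ L L' M → (L ∷ L' ∷ M) ≈ₘ (L' ∷ L ∷ M)
    trans : ∀ {M M' M''} → M ≈ₘ M' → M' ≈ₘ M'' → M ≈ₘ M''

mutual
  sizeL : Lin → ℕ
  sizeL (M ⊸ N) = 1 + sizeM M + sizeM N

  sizeM : MType → ℕ
  sizeM []      = 0
  sizeM (L ∷ M) = sizeL L + sizeM M

TCtx : ℕ → Set
TCtx n = Vec MType n

sizeCtx : ∀ {n} → TCtx n → ℕ
sizeCtx []      = 0
sizeCtx (M ∷ Γ) = sizeM M + sizeCtx Γ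

_⊎_ : ∀ {n} → TCtx n → TCtx n → TCtx n
_⊎_ = zipWith _++_

empty : ∀ {n} → TCtx n
empty = replicate _ 𝟎

single : ∀ {n} → Fin n → MType → TCtx n
single zero    M = M ∷ empty
single (suc x) M = 𝟎 ∷ single x M

EmptyDom : ∀ {n} → TCtx n → Set
EmptyDom Γ = All (_≡ 𝟎) Γ

mutual
  data _⊢_∶_ {n : ℕ} : TCtx n → Tm n → MType → Set where
    ax   : ∀ x M → single x M ⊢ var x ∶ M
    app  : ∀ {Γ Δ t u M N} → Γ ⊢ t ∶ ((M ⊸ N) ∷ []) → Δ ⊢ u ∶ M → (Γ ⊎ Δ) ⊢ app t u ∶ N
    lam  : ∀ {Γ t A} → Γ ⊢λ t ∶ A → Γ ⊢ lam t ∶ A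
    -- multi types are multisets: derivations are up to permutation
    conv : ∀ {Γ t M M'} → Γ ⊢ t ∶ M → M ≈ₘ M' → Γ ⊢ t ∶ M'

  -- the n ≥ 0 premises  Γₖ , x : Mₖ ⊢ t : Nₖ  of the (λ) rule
  data _⊢λ_∶_ {n : ℕ} : TCtx n → Tm (suc n) → MType → Set where
    []  : ∀ {t} → empty ⊢λ t ∶ []
    _∷_ : ∀ {Γ Γ' t M N A} → (M ∷ Γ) ⊢ t ∶ N → Γ' ⊢λ t ∶ A →
          (Γ ⊎ Γ') ⊢λ t ∶ ((M ⊸ N) ∷ A)

data _⊢ₚ_∶_ {n : ℕ} : TCtx n → Prog n → MType → Set where
  esε : ∀ {Γ t M} → Γ ⊢ t ∶ M → Γ ⊢ₚ ⟨ t , ε ⟩ ∶ M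
  es-snoc : ∀ {Γ Δ m M N} {t : Tm m} {E : Env (suc n) m} {i : Tm n} (ii : IsInert i) →
        (M ∷ Γ) ⊢ₚ ⟨ t , E ⟩ ∶ N → Δ ⊢ i ∶ M → (Γ ⊎ Δ) ⊢ₚ ⟨ t , E ∷ʳ (i , ii) ⟩ ∶ N

mutual
  sizeD : ∀ {n} {Γ : TCtx n} {t M} → Γ ⊢ t ∶ M → ℕ
  sizeD (ax x M)   = 0
  sizeD (app π ρ)  = suc (sizeD π + sizeD ρ)
  sizeD (lam πs)   = sizeΛ πs
  sizeD (conv π _) = sizeD π

  sizeΛ : ∀ {n} {Γ : TCtx n} {t A} → Γ ⊢λ t ∶ A → ℕ
  sizeΛ []       = 0
  sizeΛ (π ∷ πs) = sizeD π + sizeΛ πs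

sizeDP : ∀ {n} {Γ : TCtx n} {p M} → Γ ⊢ₚ p ∶ M → ℕ
sizeDP (esε π)      = sizeD π
sizeDP (es-snoc _ π ρ)  = sizeDP π + sizeD ρ

data InertM : MType → Set where
  []  : InertM []
  _∷_ : ∀ {N A} → InertM N → InertM A → InertM ((𝟎 ⊸ N) ∷ A)

InertCtx : ∀ {n} → TCtx n → Set
InertCtx Γ = All InertM Γ

InertDeriv : ∀ {n} {Γ : TCtx n} {p M} → Γ ⊢ₚ p ∶ M → Set
InertDeriv {Γ = Γ} {M = M} _ = InertCtx Γ × InertM M

Tight : ∀ {n} {Γ : TCtx n} {p M} → Γ ⊢ₚ p ∶ M → Set
Tight {M = M} π = InertDeriv π × M ≡ 𝟎

-- Subject reduction is quantitative: a βf step on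
-- a typed program is mirrored by a derivation of the reduct, in an equivalent context, with exactly
-- one (@) rule fewer. For βv this is the substitution lemma, which distributes the derivation of the
-- value among the occurrences of the variable; for βi the derivation of the inert argument becomes
-- the premise typing the new explicit substitution. Hence evaluation stops after at most |π| steps,
-- and by progress it stops at a fireball under inert substitutions. There an inert context leaves no
-- freedom: every application in an inert term costs one (@) rule and contributes one arrow to the
-- context, so the remaining derivation has exactly |q| = |Γ| (@) rules. If Γ is empty, |q| = 0 forces
-- a value without explicit substitutions.

module Submission where

open import Defs
open import Data.Nat using (ℕ; zero; suc; _+_)
open import Data.Nat.Properties using (+-identityʳ; +-assoc; +-comm; +-suc; suc-injective; +-cancelˡ-≡; m+n≡0⇒m≡0; +-commutativeSemigroup)
open import Data.Fin using (Fin; zero; suc)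
open import Data.List using ([]; _∷_; _++_; length)
open import Data.List.Properties using (++-identityʳ; ++-assoc)
open import Data.Vec using (Vec; []; _∷_; lookup; map)
open import Data.Vec.Properties using (lookup-map; zipWith-assoc; zipWith-identityˡ; zipWith-identityʳ)
open import Data.Vec.Relation.Unary.All using ([]; _∷_)
open import Data.Vec.Relation.Binary.Pointwise.Inductive as Pw using (Pointwise; []; _∷_)
open import Data.Product using (Σ; ∃; _×_; _,_; proj₁)
open import Data.Sum using (inj₁; inj₂) renaming (_⊎_ to _⊎′_)
open import Data.Empty using (⊥-elim)
open import Relation.Nullary using (¬_)
open import Function using (_∘′_)
open import Algebra.Bundles using (CommutativeSemigroup)
open import Algebra.Structures using (IsCommutativeSemigroup)
open import Relation.Binary.Structures using (IsEquivalence)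
open import Relation.Binary.PropositionalEquality as ≡ using (_≡_; refl; cong; cong₂; module ≡-Reasoning)
import Algebra.Properties.CommutativeSemigroup as CommSemigroupProperties

module ℕ+ = CommSemigroupProperties +-commutativeSemigroup

ext-cong : ∀ {n m} {ρ ρ' : Fin n → Fin m} → (∀ x → ρ x ≡ ρ' x) → ∀ x → ext ρ x ≡ ext ρ' x
ext-cong ρ≗ρ' zero    = refl
ext-cong ρ≗ρ' (suc x) = cong suc (ρ≗ρ' x)

rename-cong : ∀ {n m} {ρ ρ' : Fin n → Fin m} → (∀ x → ρ x ≡ ρ' x) → ∀ t → rename ρ t ≡ rename ρ' t
rename-cong ρ≗ρ' (var x)   = cong var (ρ≗ρ' x)
rename-cong ρ≗ρ' (lam t)   = cong lam (rename-cong (ext-cong ρ≗ρ') t)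
rename-cong ρ≗ρ' (app t u) = cong₂ app (rename-cong ρ≗ρ' t) (rename-cong ρ≗ρ' u)

exts-cong : ∀ {n m} {σ σ' : Fin n → Tm m} → (∀ x → σ x ≡ σ' x) → ∀ x → exts σ x ≡ exts σ' x
exts-cong σ≗σ' zero    = refl
exts-cong σ≗σ' (suc x) = cong wk (σ≗σ' x)

subst-cong : ∀ {n m} {σ σ' : Fin n → Tm m} → (∀ x → σ x ≡ σ' x) → ∀ t → subst σ t ≡ subst σ' t
subst-cong σ≗σ' (var x)   = σ≗σ' x
subst-cong σ≗σ' (lam t)   = cong lam (subst-cong (exts-cong σ≗σ') t)
subst-cong σ≗σ' (app t u) = cong₂ app (subst-cong σ≗σ' t) (subst-cong σ≗σ' u)

vars : ∀ n → Vec (Tm n) n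
vars zero    = []
vars (suc n) = var zero ∷ map wk (vars n)

lookup-vars : ∀ {n} (x : Fin n) → lookup (vars n) x ≡ var x
lookup-vars zero            = refl
lookup-vars {suc n} (suc x) = ≡.trans (lookup-map x wk (vars n)) (cong wk (lookup-vars x))

exts-lookup : ∀ {n m} (vs : Vec (Tm m) n) x → exts (lookup vs) x ≡ lookup (var zero ∷ map wk vs) x
exts-lookup vs zero    = refl
exts-lookup vs (suc x) = ≡.sym (lookup-map x wk vs)

[]-as-subst : ∀ {n} (t : Tm (suc n)) u → t [ u ] ≡ subst (lookup (u ∷ vars n)) t
[]-as-subst t u = subst-cong (λ { zero → refl ; (suc x) → ≡.sym (lookup-vars x) }) t

isVal-wk : ∀ {n} {v : Tm n} → IsVal v → IsVal (wk v)
isVal-wk (var x) = var (suc x)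
isVal-wk (lam t) = lam _

mutual
  ≈ₗ-refl : ∀ {L} → L ≈ₗ L
  ≈ₗ-refl {M ⊸ N} = ⊸-cong ≈ₘ-refl ≈ₘ-refl

  ≈ₘ-refl : ∀ {M} → M ≈ₘ M
  ≈ₘ-refl {[]}    = []
  ≈ₘ-refl {L ∷ M} = ≈ₗ-refl ∷ ≈ₘ-refl

mutual
  ≈ₗ-sym : ∀ {L L'} → L ≈ₗ L' → L' ≈ₗ L
  ≈ₗ-sym (⊸-cong M≈ N≈) = ⊸-cong (≈ₘ-sym M≈) (≈ₘ-sym N≈)

  ≈ₘ-sym : ∀ {M M'} → M ≈ₘ M' → M' ≈ₘ M
  ≈ₘ-sym []             = []
  ≈ₘ-sym (L≈ ∷ M≈)      = ≈ₗ-sym L≈ ∷ ≈ₘ-sym M≈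
  ≈ₘ-sym (swap L L' M)  = swap L' L M
  ≈ₘ-sym (trans M≈ M'≈) = trans (≈ₘ-sym M'≈) (≈ₘ-sym M≈)

≈ₗ-trans : ∀ {L L' L''} → L ≈ₗ L' → L' ≈ₗ L'' → L ≈ₗ L''
≈ₗ-trans (⊸-cong M≈ N≈) (⊸-cong M'≈ N'≈) = ⊸-cong (trans M≈ M'≈) (trans N≈ N'≈)

≡⇒≈ₘ : ∀ {M M'} → M ≡ M' → M ≈ₘ M'
≡⇒≈ₘ refl = ≈ₘ-refl

≈ₘ-isEquivalence : IsEquivalence _≈ₘ_
≈ₘ-isEquivalence = record { refl = ≈ₘ-refl ; sym = ≈ₘ-sym ; trans = trans }

++⁺ˡ-≈ₘ : ∀ {A A'} B → A ≈ₘ A' → (A ++ B) ≈ₘ (A' ++ B)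
++⁺ˡ-≈ₘ B []             = ≈ₘ-refl
++⁺ˡ-≈ₘ B (L≈ ∷ A≈)      = L≈ ∷ ++⁺ˡ-≈ₘ B A≈
++⁺ˡ-≈ₘ B (swap L L' A)  = swap L L' (A ++ B)
++⁺ˡ-≈ₘ B (trans A≈ A'≈) = trans (++⁺ˡ-≈ₘ B A≈) (++⁺ˡ-≈ₘ B A'≈)

++⁺ʳ-≈ₘ : ∀ A {B B'} → B ≈ₘ B' → (A ++ B) ≈ₘ (A ++ B')
++⁺ʳ-≈ₘ []      B≈ = B≈
++⁺ʳ-≈ₘ (L ∷ A) B≈ = ≈ₗ-refl ∷ ++⁺ʳ-≈ₘ A B≈

++-cong-≈ₘ : ∀ {A A' B B'} → A ≈ₘ A' → B ≈ₘ B' → (A ++ B) ≈ₘ (A' ++ B')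
++-cong-≈ₘ {A' = A'} {B = B} A≈ B≈ = trans (++⁺ˡ-≈ₘ B A≈) (++⁺ʳ-≈ₘ A' B≈)

∷-≈ₘ-∷ʳ-++ : ∀ L A B → (L ∷ (A ++ B)) ≈ₘ (A ++ (L ∷ B))
∷-≈ₘ-∷ʳ-++ L []       B = ≈ₘ-refl
∷-≈ₘ-∷ʳ-++ L (L' ∷ A) B = trans (swap L L' (A ++ B)) (≈ₗ-refl ∷ ∷-≈ₘ-∷ʳ-++ L A B)

++-comm-≈ₘ : ∀ A B → (A ++ B) ≈ₘ (B ++ A)
++-comm-≈ₘ []      B = ≡⇒≈ₘ (≡.sym (++-identityʳ B))
++-comm-≈ₘ (L ∷ A) B = trans (≈ₗ-refl ∷ ++-comm-≈ₘ A B) (∷-≈ₘ-∷ʳ-++ L B A)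

mutual
  sizeL-resp-≈ₗ : ∀ {L L'} → L ≈ₗ L' → sizeL L ≡ sizeL L'
  sizeL-resp-≈ₗ (⊸-cong M≈ N≈) = cong₂ (λ m n → suc (m + n)) (sizeM-resp-≈ₘ M≈) (sizeM-resp-≈ₘ N≈)

  sizeM-resp-≈ₘ : ∀ {M M'} → M ≈ₘ M' → sizeM M ≡ sizeM M'
  sizeM-resp-≈ₘ []             = refl
  sizeM-resp-≈ₘ (L≈ ∷ M≈)      = cong₂ _+_ (sizeL-resp-≈ₗ L≈) (sizeM-resp-≈ₘ M≈)
  sizeM-resp-≈ₘ (swap L L' M)  = ℕ+.x∙yz≈y∙xz (sizeL L) (sizeL L') (sizeM M)
  sizeM-resp-≈ₘ (trans M≈ M'≈) = ≡.trans (sizeM-resp-≈ₘ M≈) (sizeM-resp-≈ₘ M'≈)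

sizeM-++ : ∀ A B → sizeM (A ++ B) ≡ sizeM A + sizeM B
sizeM-++ []      B = refl
sizeM-++ (L ∷ A) B = ≡.trans (cong (sizeL L +_) (sizeM-++ A B)) (≡.sym (+-assoc (sizeL L) _ _))

length-resp-≈ₘ : ∀ {M M'} → M ≈ₘ M' → length M ≡ length M'
length-resp-≈ₘ []             = refl
length-resp-≈ₘ (_ ∷ M≈)       = cong suc (length-resp-≈ₘ M≈)
length-resp-≈ₘ (swap _ _ _)   = refl
length-resp-≈ₘ (trans M≈ M'≈) = ≡.trans (length-resp-≈ₘ M≈) (length-resp-≈ₘ M'≈)

≈ₘ-𝟎 : ∀ {M} → M ≈ₘ 𝟎 → M ≡ 𝟎
≈ₘ-𝟎 {[]}    _  = refl
≈ₘ-𝟎 {_ ∷ _} M≈ with length-resp-≈ₘ M≈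
... | ()

𝟎-≈ₘ : ∀ {M} → 𝟎 ≈ₘ M → M ≡ 𝟎
𝟎-≈ₘ = ≈ₘ-𝟎 ∘′ ≈ₘ-sym

singleton-≈ₘ : ∀ {L L'} → (L ∷ []) ≈ₘ (L' ∷ []) → L ≈ₗ L'
singleton-≈ₘ (L≈ ∷ _)                     = L≈
singleton-≈ₘ (trans {M' = _ ∷ []} M≈ M'≈) = ≈ₗ-trans (singleton-≈ₘ M≈) (singleton-≈ₘ M'≈)
singleton-≈ₘ (trans {M' = []} M≈ _) with length-resp-≈ₘ M≈
... | ()
singleton-≈ₘ (trans {M' = _ ∷ _ ∷ _} M≈ _) with length-resp-≈ₘ M≈
... | ()

≈ₘ-singleton : ∀ {A L} → A ≈ₘ (L ∷ []) → ∃ λ L₀ → A ≡ L₀ ∷ [] × L₀ ≈ₗ L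
≈ₘ-singleton {L₀ ∷ []} A≈ = L₀ , refl , singleton-≈ₘ A≈
≈ₘ-singleton {[]} A≈ with length-resp-≈ₘ A≈
... | ()
≈ₘ-singleton {_ ∷ _ ∷ _} A≈ with length-resp-≈ₘ A≈
... | ()

InertM-resp-≈ₘ : ∀ {M M'} → M ≈ₘ M' → InertM M → InertM M'
InertM-resp-≈ₘ []                  []              = []
InertM-resp-≈ₘ (⊸-cong 𝟎≈ N≈ ∷ A≈) (iN ∷ iA) with 𝟎-≈ₘ 𝟎≈
... | refl = InertM-resp-≈ₘ N≈ iN ∷ InertM-resp-≈ₘ A≈ iA
InertM-resp-≈ₘ (swap _ _ _)        (iL ∷ iL' ∷ iM) = iL' ∷ iL ∷ iM
InertM-resp-≈ₘ (trans M≈ M'≈)      iM              = InertM-resp-≈ₘ M'≈ (InertM-resp-≈ₘ M≈ iM)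

InertM-++⁻ : ∀ A {B} → InertM (A ++ B) → InertM A × InertM B
InertM-++⁻ []            iB        = [] , iB
InertM-++⁻ ((_ ⊸ _) ∷ A) (iN ∷ iAB) with InertM-++⁻ A iAB
... | iA , iB = iN ∷ iA , iB

_≈ᶜ_ : ∀ {n} → TCtx n → TCtx n → Set
_≈ᶜ_ = Pointwise _≈ₘ_

≈ᶜ-refl : ∀ {n} {Γ : TCtx n} → Γ ≈ᶜ Γ
≈ᶜ-refl = Pw.refl ≈ₘ-refl

≈ᶜ-sym : ∀ {n} {Γ Γ' : TCtx n} → Γ ≈ᶜ Γ' → Γ' ≈ᶜ Γ
≈ᶜ-sym = Pw.sym ≈ₘ-sym

≈ᶜ-trans : ∀ {n} {Γ Γ' Γ'' : TCtx n} → Γ ≈ᶜ Γ' → Γ' ≈ᶜ Γ'' → Γ ≈ᶜ Γ''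
≈ᶜ-trans = Pw.trans trans

≡⇒≈ᶜ : ∀ {n} {Γ Γ' : TCtx n} → Γ ≡ Γ' → Γ ≈ᶜ Γ'
≡⇒≈ᶜ refl = ≈ᶜ-refl

⊎-identityˡ : ∀ {n} (Γ : TCtx n) → empty ⊎ Γ ≡ Γ
⊎-identityˡ = zipWith-identityˡ λ _ → refl

⊎-identityʳ : ∀ {n} (Γ : TCtx n) → Γ ⊎ empty ≡ Γ
⊎-identityʳ = zipWith-identityʳ ++-identityʳ

⊎-assoc : ∀ {n} (Γ Δ Θ : TCtx n) → (Γ ⊎ Δ) ⊎ Θ ≡ Γ ⊎ (Δ ⊎ Θ)
⊎-assoc = zipWith-assoc ++-assoc

⊎-cong : ∀ {n} {Γ Γ' Δ Δ' : TCtx n} → Γ ≈ᶜ Γ' → Δ ≈ᶜ Δ' → (Γ ⊎ Δ) ≈ᶜ (Γ' ⊎ Δ')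
⊎-cong = Pw.zipWith-cong ++-cong-≈ₘ

⊎-comm : ∀ {n} (Γ Δ : TCtx n) → (Γ ⊎ Δ) ≈ᶜ (Δ ⊎ Γ)
⊎-comm = Pw.zipWith-comm ++-comm-≈ₘ

⊎-isCommutativeSemigroup : ∀ n → IsCommutativeSemigroup (_≈ᶜ_ {n}) _⊎_
⊎-isCommutativeSemigroup n = record
  { isSemigroup = record
    { isMagma = record
      { isEquivalence = Pw.isEquivalence ≈ₘ-isEquivalence n
      ; ∙-cong        = ⊎-cong
      }
    ; assoc = λ Γ Δ Θ → ≡⇒≈ᶜ (⊎-assoc Γ Δ Θ)
    }
  ; comm = ⊎-comm
  }

⊎-commutativeSemigroup : ℕ → CommutativeSemigroup _ _
⊎-commutativeSemigroup n = record { isCommutativeSemigroup = ⊎-isCommutativeSemigroup n }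

module ⊎ᶜ {n : ℕ} = CommSemigroupProperties (⊎-commutativeSemigroup n)

single-𝟎 : ∀ {n} (x : Fin n) → single x 𝟎 ≡ empty
single-𝟎 zero    = refl
single-𝟎 (suc x) = cong (𝟎 ∷_) (single-𝟎 x)

single-++ : ∀ {n} (x : Fin n) A B → single x (A ++ B) ≡ single x A ⊎ single x B
single-++ zero    A B = cong ((A ++ B) ∷_) (≡.sym (⊎-identityˡ empty))
single-++ (suc x) A B = cong (𝟎 ∷_) (single-++ x A B)

sizeCtx-⊎ : ∀ {n} (Γ Δ : TCtx n) → sizeCtx (Γ ⊎ Δ) ≡ sizeCtx Γ + sizeCtx Δ
sizeCtx-⊎ []      []      = refl
sizeCtx-⊎ (A ∷ Γ) (B ∷ Δ) = ≡.trans (cong₂ _+_ (sizeM-++ A B) (sizeCtx-⊎ Γ Δ))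
                                    (ℕ+.interchange (sizeM A) (sizeM B) (sizeCtx Γ) (sizeCtx Δ))

sizeCtx-resp-≈ᶜ : ∀ {n} {Γ Γ' : TCtx n} → Γ ≈ᶜ Γ' → sizeCtx Γ ≡ sizeCtx Γ'
sizeCtx-resp-≈ᶜ []        = refl
sizeCtx-resp-≈ᶜ (M≈ ∷ Γ≈) = cong₂ _+_ (sizeM-resp-≈ₘ M≈) (sizeCtx-resp-≈ᶜ Γ≈)

sizeCtx-empty : ∀ n → sizeCtx (empty {n}) ≡ 0
sizeCtx-empty zero    = refl
sizeCtx-empty (suc n) = sizeCtx-empty n

sizeCtx-single : ∀ {n} (x : Fin n) M → sizeCtx (single x M) ≡ sizeM M
sizeCtx-single {suc n} zero M = ≡.trans (cong (sizeM M +_) (sizeCtx-empty n)) (+-identityʳ _)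
sizeCtx-single (suc x)     M = sizeCtx-single x M

sizeCtx-EmptyDom : ∀ {n} {Γ : TCtx n} → EmptyDom Γ → sizeCtx Γ ≡ 0
sizeCtx-EmptyDom []          = refl
sizeCtx-EmptyDom (refl ∷ 𝟎s) = sizeCtx-EmptyDom 𝟎s

InertCtx-resp-≈ᶜ : ∀ {n} {Γ Γ' : TCtx n} → Γ ≈ᶜ Γ' → InertCtx Γ → InertCtx Γ'
InertCtx-resp-≈ᶜ []        []        = []
InertCtx-resp-≈ᶜ (M≈ ∷ Γ≈) (iM ∷ iΓ) = InertM-resp-≈ₘ M≈ iM ∷ InertCtx-resp-≈ᶜ Γ≈ iΓ

InertCtx-⊎⁻ : ∀ {n} (Γ Δ : TCtx n) → InertCtx (Γ ⊎ Δ) → InertCtx Γ × InertCtx Δ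
InertCtx-⊎⁻ []      []      []          = [] , []
InertCtx-⊎⁻ (A ∷ Γ) (B ∷ Δ) (iAB ∷ iΓΔ) with InertM-++⁻ A iAB | InertCtx-⊎⁻ Γ Δ iΓΔ
... | iA , iB | iΓ , iΔ = iA ∷ iΓ , iB ∷ iΔ

InertCtx-single⁻ : ∀ {n} (x : Fin n) {M} → InertCtx (single x M) → InertM M
InertCtx-single⁻ zero    (iM ∷ _) = iM
InertCtx-single⁻ (suc x) (_ ∷ iΓ) = InertCtx-single⁻ x iΓ

_⊢[_]_∶_ : ∀ {n} → TCtx n → ℕ → Tm n → MType → Set
Γ ⊢[ k ] t ∶ M = Σ (Γ ⊢ t ∶ M) λ π → sizeD π ≡ k

⊢-ctx-≡ : ∀ {n} {Γ Γ' : TCtx n} {k t M} → Γ ≡ Γ' → Γ ⊢[ k ] t ∶ M → Γ' ⊢[ k ] t ∶ M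
⊢-ctx-≡ refl d = d

⊢-conv : ∀ {n} {Γ : TCtx n} {k t M M'} → Γ ⊢[ k ] t ∶ M → M ≈ₘ M' → Γ ⊢[ k ] t ∶ M'
⊢-conv (π , |π|≡k) M≈ = conv π M≈ , |π|≡k

⊢λ-ctx-≡ : ∀ {n} {Γ Γ' : TCtx n} {t A} → Γ ≡ Γ' → (πs : Γ ⊢λ t ∶ A) →
  Σ (Γ' ⊢λ t ∶ A) λ πs' → sizeΛ πs' ≡ sizeΛ πs
⊢λ-ctx-≡ refl πs = πs , refl

data Thinning : ℕ → ℕ → Set where
  done : Thinning 0 0
  keep : ∀ {n m} → Thinning n m → Thinning (suc n) (suc m)
  skip : ∀ {n m} → Thinning n m → Thinning n (suc m)

⟦_⟧ᵗ : ∀ {n m} → Thinning n m → Fin n → Fin m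
⟦ done ⟧ᵗ   ()
⟦ keep θ ⟧ᵗ = ext ⟦ θ ⟧ᵗ
⟦ skip θ ⟧ᵗ = suc ∘′ ⟦ θ ⟧ᵗ

thin-ctx : ∀ {n m} → Thinning n m → TCtx n → TCtx m
thin-ctx done     []      = []
thin-ctx (keep θ) (M ∷ Γ) = M ∷ thin-ctx θ Γ
thin-ctx (skip θ) Γ       = 𝟎 ∷ thin-ctx θ Γ

thin-id : ∀ n → Thinning n n
thin-id zero    = done
thin-id (suc n) = keep (thin-id n)

⟦thin-id⟧ : ∀ {n} (x : Fin n) → ⟦ thin-id n ⟧ᵗ x ≡ x
⟦thin-id⟧ zero    = refl
⟦thin-id⟧ (suc x) = cong suc (⟦thin-id⟧ x)

thin-ctx-id : ∀ {n} (Γ : TCtx n) → thin-ctx (thin-id n) Γ ≡ Γ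
thin-ctx-id []      = refl
thin-ctx-id (M ∷ Γ) = cong (M ∷_) (thin-ctx-id Γ)

thin-ctx-⊎ : ∀ {n m} (θ : Thinning n m) Γ Δ → thin-ctx θ (Γ ⊎ Δ) ≡ thin-ctx θ Γ ⊎ thin-ctx θ Δ
thin-ctx-⊎ done     []      []      = refl
thin-ctx-⊎ (keep θ) (A ∷ Γ) (B ∷ Δ) = cong ((A ++ B) ∷_) (thin-ctx-⊎ θ Γ Δ)
thin-ctx-⊎ (skip θ) Γ       Δ       = cong (𝟎 ∷_) (thin-ctx-⊎ θ Γ Δ)

thin-ctx-empty : ∀ {n m} (θ : Thinning n m) → thin-ctx θ empty ≡ empty
thin-ctx-empty done     = refl
thin-ctx-empty (keep θ) = cong (𝟎 ∷_) (thin-ctx-empty θ)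
thin-ctx-empty (skip θ) = cong (𝟎 ∷_) (thin-ctx-empty θ)

thin-ctx-single : ∀ {n m} (θ : Thinning n m) x M → thin-ctx θ (single x M) ≡ single (⟦ θ ⟧ᵗ x) M
thin-ctx-single (keep θ) zero    M = cong (M ∷_) (thin-ctx-empty θ)
thin-ctx-single (keep θ) (suc x) M = cong (𝟎 ∷_) (thin-ctx-single θ x M)
thin-ctx-single (skip θ) x       M = cong (𝟎 ∷_) (thin-ctx-single θ x M)

mutual
  ⊢-thin : ∀ {n m} (θ : Thinning n m) {Γ t M} (π : Γ ⊢ t ∶ M) →
    thin-ctx θ Γ ⊢[ sizeD π ] rename ⟦ θ ⟧ᵗ t ∶ M
  ⊢-thin θ (ax x M) = ⊢-ctx-≡ (≡.sym (thin-ctx-single θ x M)) (ax (⟦ θ ⟧ᵗ x) M , refl)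
  ⊢-thin θ (app {Γ = Γ} {Δ = Δ} π ρ) with ⊢-thin θ π | ⊢-thin θ ρ
  ... | π' , |π'| | ρ' , |ρ'| =
    ⊢-ctx-≡ (≡.sym (thin-ctx-⊎ θ Γ Δ)) (app π' ρ' , cong₂ (λ a b → suc (a + b)) |π'| |ρ'|)
  ⊢-thin θ (lam πs) with ⊢λ-thin θ πs
  ... | πs' , |πs'| = lam πs' , |πs'|
  ⊢-thin θ (conv π M≈) = ⊢-conv (⊢-thin θ π) M≈

  ⊢λ-thin : ∀ {n m} (θ : Thinning n m) {Γ t A} (πs : Γ ⊢λ t ∶ A) →
    Σ (thin-ctx θ Γ ⊢λ rename ⟦ keep θ ⟧ᵗ t ∶ A) λ πs' → sizeΛ πs' ≡ sizeΛ πs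
  ⊢λ-thin θ [] = ⊢λ-ctx-≡ (≡.sym (thin-ctx-empty θ)) []
  ⊢λ-thin θ (_∷_ {Γ = Γ} {Γ' = Γ'} π πs) with ⊢-thin (keep θ) π | ⊢λ-thin θ πs
  ... | π' , |π'| | πs' , |πs'| with ⊢λ-ctx-≡ (≡.sym (thin-ctx-⊎ θ Γ Γ')) (π' ∷ πs')
  ... | πs'' , |πs''| = πs'' , ≡.trans |πs''| (cong₂ _+_ |π'| |πs'|)

⊢-weaken : ∀ {n} {Γ : TCtx n} {k t M} → Γ ⊢[ k ] t ∶ M → (𝟎 ∷ Γ) ⊢[ k ] wk t ∶ M
⊢-weaken {n} {Γ} {t = t} (π , refl) with ⊢-thin (skip (thin-id n)) π
... | π' , |π'| =
  ≡.subst (λ s → (𝟎 ∷ Γ) ⊢[ sizeD π ] s ∶ _) (rename-cong (λ x → cong suc (⟦thin-id⟧ x)) t)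
    (⊢-ctx-≡ (cong (𝟎 ∷_) (thin-ctx-id Γ)) (π' , |π'|))

var-inv : ∀ {n} {Γ : TCtx n} {x M} (π : Γ ⊢ var x ∶ M) →
  ∃ λ M₀ → Γ ≡ single x M₀ × M₀ ≈ₘ M × sizeD π ≡ 0
var-inv (ax x M)    = M , refl , ≈ₘ-refl , refl
var-inv (conv π M≈) with var-inv π
... | M₀ , Γ≡ , M₀≈ , |π| = M₀ , Γ≡ , trans M₀≈ M≈ , |π|

lam-inv : ∀ {n} {Γ : TCtx n} {t M} (π : Γ ⊢ lam t ∶ M) →
  ∃ λ A → Σ (Γ ⊢λ t ∶ A) λ πs → A ≈ₘ M × sizeΛ πs ≡ sizeD π
lam-inv (lam πs)    = _ , πs , ≈ₘ-refl , refl
lam-inv (conv π M≈) with lam-inv π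
... | A , πs , A≈ , |πs| = A , πs , trans A≈ M≈ , |πs|

record AppInversion {n} (Γ : TCtx n) (t u : Tm n) (N : MType) (k : ℕ) : Set where
  constructor app-inversion
  field
    {Γ₁ Γ₂} : TCtx n
    {M₀ N₀} : MType
    π₁      : Γ₁ ⊢ t ∶ ((M₀ ⊸ N₀) ∷ [])
    π₂      : Γ₂ ⊢ u ∶ M₀
    ctx≡    : Γ ≡ Γ₁ ⊎ Γ₂
    N₀≈N    : N₀ ≈ₘ N
    size≡   : k ≡ suc (sizeD π₁ + sizeD π₂)

app-inv : ∀ {n} {Γ : TCtx n} {t u N} (π : Γ ⊢ app t u ∶ N) → AppInversion Γ t u N (sizeD π)
app-inv (app π ρ)   = app-inversion π ρ refl ≈ₘ-refl refl
app-inv (conv π N≈) with app-inv π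
... | app-inversion π₁ π₂ Γ≡ N₀≈ |π| = app-inversion π₁ π₂ Γ≡ (trans N₀≈ N≈) |π|

record LamInversion {n} (Γ : TCtx n) (t : Tm (suc n)) (M N : MType) (k : ℕ) : Set where
  constructor lam-inversion
  field
    {M₁ N₁} : MType
    π₀      : (M₁ ∷ Γ) ⊢ t ∶ N₁
    M₁≈M    : M₁ ≈ₘ M
    N₁≈N    : N₁ ≈ₘ N
    size≡   : k ≡ sizeD π₀

lam-inv-⊸ : ∀ {n} {Γ : TCtx n} {t M N} (π : Γ ⊢ lam t ∶ ((M ⊸ N) ∷ [])) → LamInversion Γ t M N (sizeD π)
lam-inv-⊸ π with lam-inv π
... | A , πs , A≈ , |πs| with ≈ₘ-singleton A≈
... | (M₁ ⊸ N₁) , refl , ⊸-cong M₁≈ N₁≈ with πs | |πs|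
... | _∷_ {Γ = Γ₀} π₀ [] | |π₀|+0 with ⊢-ctx-≡ (cong (M₁ ∷_) (≡.sym (⊎-identityʳ Γ₀))) (π₀ , refl)
... | π₀' , |π₀'| = lam-inversion π₀' M₁≈ N₁≈ (≡.trans (≡.sym |π₀|+0) (≡.trans (+-identityʳ _) (≡.sym |π₀'|)))

⊢λ-𝟎 : ∀ {n} {Γ : TCtx n} {t} (πs : Γ ⊢λ t ∶ 𝟎) → Γ ≡ empty × sizeΛ πs ≡ 0
⊢λ-𝟎 [] = refl , refl

val-𝟎 : ∀ {n} {Γ : TCtx n} {v} → IsVal v → (π : Γ ⊢ v ∶ 𝟎) → Γ ≡ empty × sizeD π ≡ 0
val-𝟎 (var x) π with var-inv π
... | M₀ , Γ≡ , M₀≈ , |π| with ≈ₘ-𝟎 M₀≈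
... | refl = ≡.trans Γ≡ (single-𝟎 x) , |π|
val-𝟎 (lam t) π with lam-inv π
... | A , πs , A≈ , |πs| with ≈ₘ-𝟎 A≈
... | refl with ⊢λ-𝟎 πs
... | Γ≡ , |πs|≡0 = Γ≡ , ≡.trans (≡.sym |πs|) |πs|≡0

⊢λ-++ : ∀ {n} {Γ Δ : TCtx n} {t A B} (πs : Γ ⊢λ t ∶ A) (ρs : Δ ⊢λ t ∶ B) →
  Σ ((Γ ⊎ Δ) ⊢λ t ∶ (A ++ B)) λ σs → sizeΛ σs ≡ sizeΛ πs + sizeΛ ρs
⊢λ-++ {Δ = Δ} [] ρs = ⊢λ-ctx-≡ (≡.sym (⊎-identityˡ Δ)) ρs
⊢λ-++ {Δ = Δ} (_∷_ {Γ = Γ₁} {Γ' = Γ₂} π πs) ρs with ⊢λ-++ πs ρs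
... | σs , |σs| with ⊢λ-ctx-≡ (≡.sym (⊎-assoc Γ₁ Γ₂ Δ)) (π ∷ σs)
... | τs , |τs| = τs , ≡.trans |τs| (≡.trans (cong (sizeD π +_) |σs|) (≡.sym (+-assoc (sizeD π) _ _)))

record Split {n} {T : Set} (J : TCtx n → ℕ → T → Set) (Γ : TCtx n) (k : ℕ) (A B : T) : Set where
  constructor split
  field
    {Γ₁ Γ₂} : TCtx n
    {k₁ k₂} : ℕ
    left    : J Γ₁ k₁ A
    right   : J Γ₂ k₂ B
    ctx≈    : Γ ≈ᶜ (Γ₁ ⊎ Γ₂)
    size≡   : k ≡ k₁ + k₂

val-merge : ∀ {n} {Γ Δ : TCtx n} {v A B a b} → IsVal v →
  Γ ⊢[ a ] v ∶ A → Δ ⊢[ b ] v ∶ B → (Γ ⊎ Δ) ⊢[ a + b ] v ∶ (A ++ B)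
val-merge (var x) (π , refl) (ρ , refl) with var-inv π | var-inv ρ
... | A₀ , refl , A₀≈ , |π| | B₀ , refl , B₀≈ , |ρ| =
  ⊢-ctx-≡ (single-++ x A₀ B₀) (conv (ax x (A₀ ++ B₀)) (++-cong-≈ₘ A₀≈ B₀≈) , ≡.sym (cong₂ _+_ |π| |ρ|))
val-merge (lam t) (π , refl) (ρ , refl) with lam-inv π | lam-inv ρ
... | A₀ , πs , A₀≈ , |πs| | B₀ , ρs , B₀≈ , |ρs| with ⊢λ-++ πs ρs
... | σs , |σs| = conv (lam σs) (++-cong-≈ₘ A₀≈ B₀≈) , ≡.trans |σs| (cong₂ _+_ |πs| |ρs|)

-- A value typed by a multi type, presented as one derivation per linear type: in this form
-- a permutation of the multi type can be pushed through the derivation.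
data _⊢*[_]_∶_ {n} : TCtx n → ℕ → Tm n → MType → Set where
  []  : ∀ {v} → empty ⊢*[ 0 ] v ∶ []
  _∷_ : ∀ {Γ Δ v L M a b} → Γ ⊢[ a ] v ∶ (L ∷ []) → Δ ⊢*[ b ] v ∶ M → (Γ ⊎ Δ) ⊢*[ a + b ] v ∶ (L ∷ M)

⊢*-cast : ∀ {n} {Γ Γ' : TCtx n} {k k' v M} → Γ ≡ Γ' → k ≡ k' → Γ ⊢*[ k ] v ∶ M → Γ' ⊢*[ k' ] v ∶ M
⊢*-cast refl refl ds = ds

var-⊢* : ∀ {n} (x : Fin n) M → single x M ⊢*[ 0 ] var x ∶ M
var-⊢* x []      = ⊢*-cast (≡.sym (single-𝟎 x)) refl []
var-⊢* x (L ∷ M) = ⊢*-cast (≡.sym (single-++ x (L ∷ []) M)) refl ((ax x (L ∷ []) , refl) ∷ var-⊢* x M)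

lam-⊢* : ∀ {n} {Γ : TCtx n} {t A} (πs : Γ ⊢λ t ∶ A) → Γ ⊢*[ sizeΛ πs ] lam t ∶ A
lam-⊢* []                  = []
lam-⊢* (_∷_ {Γ = Γ₁} π πs) =
  ⊢-ctx-≡ (⊎-identityʳ Γ₁) (lam (π ∷ []) , +-identityʳ (sizeD π)) ∷ lam-⊢* πs

⊢*-perm : ∀ {n} {Γ : TCtx n} {k v A B} → Γ ⊢*[ k ] v ∶ A → A ≈ₘ B →
  ∃ λ Γ' → Γ' ⊢*[ k ] v ∶ B × Γ' ≈ᶜ Γ
⊢*-perm [] [] = _ , [] , ≈ᶜ-refl
⊢*-perm (d ∷ ds) (L≈ ∷ M≈) with ⊢*-perm ds M≈
... | Δ' , ds' , Δ'≈ = _ , ⊢-conv d (L≈ ∷ []) ∷ ds' , ⊎-cong ≈ᶜ-refl Δ'≈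
⊢*-perm (_∷_ {Γ = Γ₁} {a = a₁} d (_∷_ {Γ = Γ₂} {Δ = Δ} {a = a₂} {b = b} d' ds)) (swap _ _ _) =
  _ , ⊢*-cast refl (ℕ+.x∙yz≈y∙xz a₂ a₁ b) (d' ∷ (d ∷ ds)) , ⊎ᶜ.x∙yz≈y∙xz Γ₂ Γ₁ Δ
⊢*-perm ds (trans A≈ A'≈) with ⊢*-perm ds A≈
... | Γ₁ , ds₁ , Γ₁≈ with ⊢*-perm ds₁ A'≈
... | Γ₂ , ds₂ , Γ₂≈ = Γ₂ , ds₂ , ≈ᶜ-trans Γ₂≈ Γ₁≈

⊢⇒⊢* : ∀ {n} {Γ : TCtx n} {v M} → IsVal v → (π : Γ ⊢ v ∶ M) →
  ∃ λ Γ' → Γ' ⊢*[ sizeD π ] v ∶ M × Γ' ≈ᶜ Γ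
⊢⇒⊢* (var x) π with var-inv π
... | M₀ , refl , M₀≈ , |π| with ⊢*-perm (var-⊢* x M₀) M₀≈
... | Γ' , ds , Γ'≈ = Γ' , ⊢*-cast refl (≡.sym |π|) ds , Γ'≈
⊢⇒⊢* (lam t) π with lam-inv π
... | A , πs , A≈ , |πs| with ⊢*-perm (lam-⊢* πs) A≈
... | Γ' , ds , Γ'≈ = Γ' , ⊢*-cast refl |πs| ds , Γ'≈

⊢*⇒⊢ : ∀ {n} {Γ : TCtx n} {k v M} → IsVal v → Γ ⊢*[ k ] v ∶ M → Γ ⊢[ k ] v ∶ M
⊢*⇒⊢ (var x) []       = ⊢-ctx-≡ (single-𝟎 x) (ax x [] , refl)
⊢*⇒⊢ (lam t) []       = lam [] , refl
⊢*⇒⊢ isv     (d ∷ ds) = val-merge isv d (⊢*⇒⊢ isv ds)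

⊢*-++⁻ : ∀ {n} {Γ : TCtx n} {k v B} A → Γ ⊢*[ k ] v ∶ (A ++ B) →
  Split (_⊢*[_] v ∶_) Γ k A B
⊢*-++⁻ {Γ = Γ} [] ds = split [] ds (≡⇒≈ᶜ (≡.sym (⊎-identityˡ Γ))) refl
⊢*-++⁻ (L ∷ A) (_∷_ {Γ = Γ₀} {a = a} d ds) with ⊢*-++⁻ A ds
... | split {Γ₁} {Γ₂} {k₁} {k₂} ds₁ ds₂ Γ≈ refl =
  split (d ∷ ds₁) ds₂ (≈ᶜ-trans (⊎-cong ≈ᶜ-refl Γ≈) (≡⇒≈ᶜ (≡.sym (⊎-assoc Γ₀ Γ₁ Γ₂)))) (≡.sym (+-assoc a k₁ k₂))

val-split : ∀ {n} {Γ : TCtx n} {k v B} A → IsVal v → Γ ⊢[ k ] v ∶ (A ++ B) →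
  Split (_⊢[_] v ∶_) Γ k A B
val-split A isv (π , refl) with ⊢⇒⊢* isv π
... | Γ' , ds , Γ'≈ with ⊢*-++⁻ A ds
... | split ds₁ ds₂ Γ'≈₁₂ |π| =
  split (⊢*⇒⊢ isv ds₁) (⊢*⇒⊢ isv ds₂) (≈ᶜ-trans (≈ᶜ-sym Γ'≈) Γ'≈₁₂) |π|

-- Substitution lemma

data _⊢ˢ[_]_∶_ {m} : ∀ {n} → TCtx m → ℕ → Vec (Tm m) n → TCtx n → Set where
  []   : empty ⊢ˢ[ 0 ] [] ∶ []
  cons : ∀ {n Δ Δ' v M a b} {vs : Vec (Tm m) n} {Γ} → IsVal v →
         Δ ⊢[ a ] v ∶ M → Δ' ⊢ˢ[ b ] vs ∶ Γ → (Δ ⊎ Δ') ⊢ˢ[ a + b ] (v ∷ vs) ∶ (M ∷ Γ)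

⊢ˢ-cast : ∀ {n m} {Δ Δ' : TCtx m} {k k'} {vs : Vec (Tm m) n} {Γ} →
  Δ ≡ Δ' → k ≡ k' → Δ ⊢ˢ[ k ] vs ∶ Γ → Δ' ⊢ˢ[ k' ] vs ∶ Γ
⊢ˢ-cast refl refl σ = σ

⊢ˢ-empty : ∀ {n m} {Δ : TCtx m} {k} {vs : Vec (Tm m) n} → Δ ⊢ˢ[ k ] vs ∶ empty → Δ ≡ empty × k ≡ 0
⊢ˢ-empty [] = refl , refl
⊢ˢ-empty (cons isv (π , refl) σ) with val-𝟎 isv π | ⊢ˢ-empty σ
... | refl , |π| | refl , refl = ⊎-identityˡ empty , ≡.trans (+-identityʳ _) |π|

⊢ˢ-lookup : ∀ {n m} {Δ : TCtx m} {k} {vs : Vec (Tm m) n} x {M} →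
  Δ ⊢ˢ[ k ] vs ∶ single x M → Δ ⊢[ k ] lookup vs x ∶ M
⊢ˢ-lookup zero (cons {Δ = Δ₀} _ (π , |π|) σ) with ⊢ˢ-empty σ
... | refl , refl = ⊢-ctx-≡ (≡.sym (⊎-identityʳ Δ₀)) (π , ≡.trans |π| (≡.sym (+-identityʳ _)))
⊢ˢ-lookup (suc x) (cons {Δ' = Δ'} isv (π , refl) σ) with val-𝟎 isv π | ⊢ˢ-lookup x σ
... | refl , |π| | ρ , |ρ| = ⊢-ctx-≡ (≡.sym (⊎-identityˡ Δ')) (ρ , ≡.trans |ρ| (cong (_+ _) (≡.sym |π|)))

⊢ˢ-⊎⁻ : ∀ {n m} {Δ : TCtx m} {k} {vs : Vec (Tm m) n} (Γ₁ Γ₂ : TCtx n) →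
  Δ ⊢ˢ[ k ] vs ∶ (Γ₁ ⊎ Γ₂) → Split (_⊢ˢ[_] vs ∶_) Δ k Γ₁ Γ₂
⊢ˢ-⊎⁻ [] [] [] = split [] [] (≡⇒≈ᶜ (≡.sym (⊎-identityˡ empty))) refl
⊢ˢ-⊎⁻ (A ∷ Γ₁) (B ∷ Γ₂) (cons isv d σ) with val-split A isv d | ⊢ˢ-⊎⁻ Γ₁ Γ₂ σ
... | split {Δa} {Δb} {ka} {kb} da db Δ≈ab refl | split {Δ₁} {Δ₂} {k₁} {k₂} σ₁ σ₂ Δ≈₁₂ refl =
  split (cons isv da σ₁) (cons isv db σ₂)
        (≈ᶜ-trans (⊎-cong Δ≈ab Δ≈₁₂) (⊎ᶜ.interchange Δa Δb Δ₁ Δ₂))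
        (ℕ+.interchange ka kb k₁ k₂)

⊢ˢ-weaken : ∀ {n m} {Δ : TCtx m} {k} {vs : Vec (Tm m) n} {Γ} →
  Δ ⊢ˢ[ k ] vs ∶ Γ → (𝟎 ∷ Δ) ⊢ˢ[ k ] map wk vs ∶ Γ
⊢ˢ-weaken []             = []
⊢ˢ-weaken (cons isv d σ) = cons (isVal-wk isv) (⊢-weaken d) (⊢ˢ-weaken σ)

⊢ˢ-ext : ∀ {n m} {Δ : TCtx m} {k} {vs : Vec (Tm m) n} {Γ} M →
  Δ ⊢ˢ[ k ] vs ∶ Γ → (M ∷ Δ) ⊢ˢ[ k ] (var zero ∷ map wk vs) ∶ (M ∷ Γ)
⊢ˢ-ext {Δ = Δ} M σ =
  ⊢ˢ-cast (cong₂ _∷_ (++-identityʳ M) (⊎-identityˡ Δ)) refl (cons (var zero) (ax zero M , refl) (⊢ˢ-weaken σ))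

⊢ˢ-vars : ∀ {n} (Γ : TCtx n) → Γ ⊢ˢ[ 0 ] vars n ∶ Γ
⊢ˢ-vars []      = []
⊢ˢ-vars (M ∷ Γ) = ⊢ˢ-ext M (⊢ˢ-vars Γ)

mutual
  ⊢-subst : ∀ {n m} {Γ : TCtx n} {t M} (π : Γ ⊢ t ∶ M) {vs : Vec (Tm m) n} {Δ k} →
    Δ ⊢ˢ[ k ] vs ∶ Γ → ∃ λ Δ' → Δ' ⊢[ sizeD π + k ] subst (lookup vs) t ∶ M × Δ' ≈ᶜ Δ
  ⊢-subst (ax x M) σ = _ , ⊢ˢ-lookup x σ , ≈ᶜ-refl
  ⊢-subst (app {Γ = Γ₁} {Δ = Γ₂} π ρ) σ with ⊢ˢ-⊎⁻ Γ₁ Γ₂ σ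
  ... | split {k₁ = k₁} {k₂} σ₁ σ₂ Δ≈ refl with ⊢-subst π σ₁ | ⊢-subst ρ σ₂
  ... | _ , (π' , |π'|) , Δ₁≈ | _ , (ρ' , |ρ'|) , Δ₂≈ =
    _ , (app π' ρ' , cong suc (≡.trans (cong₂ _+_ |π'| |ρ'|) (ℕ+.interchange (sizeD π) k₁ (sizeD ρ) k₂))) ,
    ≈ᶜ-trans (⊎-cong Δ₁≈ Δ₂≈) (≈ᶜ-sym Δ≈)
  ⊢-subst (lam {t = t} {A = A} πs) {vs} {k = k} σ with ⊢λ-subst πs σ
  ... | Δ' , A' , πs' , |πs'| , A'≈ , Δ'≈ =
    Δ' , ≡.subst (λ s → Δ' ⊢[ sizeΛ πs + k ] s ∶ A) (cong lam (≡.sym (subst-cong (exts-lookup vs) t)))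
                 (conv (lam πs') A'≈ , |πs'|) , Δ'≈
  ⊢-subst (conv π M≈) σ with ⊢-subst π σ
  ... | Δ' , d , Δ'≈ = Δ' , ⊢-conv d M≈ , Δ'≈

  ⊢λ-subst : ∀ {n m} {Γ : TCtx n} {t A} (πs : Γ ⊢λ t ∶ A) {vs : Vec (Tm m) n} {Δ k} →
    Δ ⊢ˢ[ k ] vs ∶ Γ → ∃ λ Δ' → ∃ λ A' → Σ (Δ' ⊢λ subst (lookup (var zero ∷ map wk vs)) t ∶ A') λ πs' →
      sizeΛ πs' ≡ sizeΛ πs + k × A' ≈ₘ A × Δ' ≈ᶜ Δ
  ⊢λ-subst [] σ with ⊢ˢ-empty σ
  ... | refl , refl = empty , [] , [] , refl , [] , ≈ᶜ-refl
  ⊢λ-subst (_∷_ {Γ = Γ₁} {Γ' = Γ₂} {M = M} π πs) σ with ⊢ˢ-⊎⁻ Γ₁ Γ₂ σ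
  ... | split {k₁ = k₁} {k₂} σ₁ σ₂ Δ≈ refl with ⊢-subst π (⊢ˢ-ext M σ₁) | ⊢λ-subst πs σ₂
  ... | (M' ∷ _) , (π' , |π'|) , (M'≈ ∷ Δ₁≈) | _ , _ , πs' , |πs'| , A'≈ , Δ₂≈ =
    _ , _ , π' ∷ πs' ,
    ≡.trans (cong₂ _+_ |π'| |πs'|) (ℕ+.interchange (sizeD π) k₁ (sizeΛ πs) k₂) ,
    ⊸-cong M'≈ ≈ₘ-refl ∷ A'≈ ,
    ≈ᶜ-trans (⊎-cong Δ₁≈ Δ₂≈) (≈ᶜ-sym Δ≈)

-- Quantitative subject reduction

⊢-βv : ∀ {n} {C : ECtx n} → RightCtx C → ∀ {t v Γ N} → IsVal v → (π : Γ ⊢ plug C (app (lam t) v) ∶ N) →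
  ∃ λ Γ' → Σ (Γ' ⊢ plug C (t [ v ]) ∶ N) λ π' → suc (sizeD π') ≡ sizeD π × Γ' ≈ᶜ Γ
⊢-βv hole {t} {v} isv π with app-inv π
... | app-inversion {Γ₁} {Γ₂} π₁ π₂ refl N₀≈ |π| with lam-inv-⊸ π₁
... | lam-inversion π₀ M₁≈ N₁≈ |π₁| with ⊢-subst π₀ (cons isv (conv π₂ (≈ₘ-sym M₁≈) , refl) (⊢ˢ-vars Γ₁))
... | Δ' , d , Δ'≈ with ≡.subst (λ s → Δ' ⊢[ sizeD π₀ + (sizeD π₂ + 0) ] s ∶ _) (≡.sym ([]-as-subst t v)) d
... | π' , |π'| = Δ' , conv π' (trans N₁≈ N₀≈) , ≡.trans size≡ (≡.sym |π|) , ≈ᶜ-trans Δ'≈ (⊎-comm Γ₂ Γ₁)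
  where
  open ≡-Reasoning
  size≡ : suc (sizeD π') ≡ suc (sizeD π₁ + sizeD π₂)
  size≡ = cong suc (begin
    sizeD π'                 ≡⟨ |π'| ⟩
    sizeD π₀ + (sizeD π₂ + 0) ≡⟨ cong₂ _+_ (≡.sym |π₁|) (+-identityʳ _) ⟩
    sizeD π₁ + sizeD π₂       ∎)
⊢-βv (argCtx u C) isv π with app-inv π
... | app-inversion {Γ₁} {Γ₂} π₁ π₂ refl N₀≈ |π| with ⊢-βv C isv π₂
... | Γ₂' , π₂' , |π₂'| , Γ₂'≈ =
  Γ₁ ⊎ Γ₂' , conv (app π₁ π₂') N₀≈ ,
  ≡.trans (cong suc (≡.trans (≡.sym (+-suc (sizeD π₁) (sizeD π₂'))) (cong (sizeD π₁ +_) |π₂'|))) (≡.sym |π|) ,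
  ⊎-cong ≈ᶜ-refl Γ₂'≈
⊢-βv (funCtx C _) isv π with app-inv π
... | app-inversion {Γ₁} {Γ₂} π₁ π₂ refl N₀≈ |π| with ⊢-βv C isv π₁
... | Γ₁' , π₁' , |π₁'| , Γ₁'≈ =
  Γ₁' ⊎ Γ₂ , conv (app π₁' π₂) N₀≈ , ≡.trans (cong suc (cong (_+ sizeD π₂) |π₁'|)) (≡.sym |π|) , ⊎-cong Γ₁'≈ ≈ᶜ-refl

-- The premises of (es@) for the βi-reduct ⟨ t , [x←i] ⟩.
record ESReduct {n} (t : Tm (suc n)) (i : Tm n) (Γ : TCtx n) (N : MType) (k : ℕ) : Set where
  constructor es-reduct
  field
    {M₀}    : MType
    {Γ' Δ}  : TCtx n
    π'      : (M₀ ∷ Γ') ⊢ t ∶ N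
    ρ       : Δ ⊢ i ∶ M₀
    size≡   : suc (sizeD π' + sizeD ρ) ≡ k
    ctx≈    : (Γ' ⊎ Δ) ≈ᶜ Γ

⊢-βi : ∀ {n} {C : ECtx n} → RightCtx C → ∀ {t i Γ N} (π : Γ ⊢ plug C (app (lam t) i) ∶ N) →
  ESReduct (plug (wkC C) t) i Γ N (sizeD π)
⊢-βi hole π with app-inv π
... | app-inversion π₁ π₂ refl N₀≈ |π| with lam-inv-⊸ π₁
... | lam-inversion π₀ M₁≈ N₁≈ |π₁| =
  es-reduct (conv π₀ (trans N₁≈ N₀≈)) (conv π₂ (≈ₘ-sym M₁≈))
            (≡.trans (cong (λ s → suc (s + sizeD π₂)) (≡.sym |π₁|)) (≡.sym |π|)) ≈ᶜ-refl
⊢-βi (argCtx u C) π with app-inv π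
... | app-inversion {Γ₁} {Γ₂} π₁ π₂ refl N₀≈ |π| with ⊢-βi C π₂
... | es-reduct {Γ' = Γ₂'} {Δ} π₂' ρ |π₂| Γ≈ with ⊢-weaken (π₁ , refl)
... | w , |w| = es-reduct (conv (app w π₂') N₀≈) ρ (≡.trans size≡ (≡.sym |π|))
                  (≈ᶜ-trans (≡⇒≈ᶜ (⊎-assoc Γ₁ Γ₂' Δ)) (⊎-cong ≈ᶜ-refl Γ≈))
  where
  open ≡-Reasoning
  size≡ : suc (suc (sizeD w + sizeD π₂') + sizeD ρ) ≡ suc (sizeD π₁ + sizeD π₂)
  size≡ = cong suc (begin
    suc (sizeD w + sizeD π₂' + sizeD ρ)      ≡⟨ cong suc (+-assoc (sizeD w) _ _) ⟩
    suc (sizeD w + (sizeD π₂' + sizeD ρ))    ≡⟨ ≡.sym (+-suc (sizeD w) _) ⟩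
    sizeD w + suc (sizeD π₂' + sizeD ρ)      ≡⟨ cong₂ _+_ |w| |π₂| ⟩
    sizeD π₁ + sizeD π₂                      ∎)
⊢-βi (funCtx C _) π with app-inv π
... | app-inversion {Γ₁} {Γ₂} π₁ π₂ refl N₀≈ |π| with ⊢-βi C π₁
... | es-reduct {M₀} {Γ₁'} {Δ} π₁' ρ |π₁| Γ≈ with ⊢-weaken (π₂ , refl)
... | w , |w| with ⊢-ctx-≡ (cong (_∷ (Γ₁' ⊎ Γ₂)) (++-identityʳ M₀)) (app π₁' w , refl)
... | π' , |π'| = es-reduct (conv π' N₀≈) ρ (≡.trans size≡ (≡.sym |π|))
                    (≈ᶜ-trans (⊎ᶜ.xy∙z≈xz∙y Γ₁' Γ₂ Δ) (⊎-cong Γ≈ ≈ᶜ-refl))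
  where
  open ≡-Reasoning
  size≡ : suc (sizeD π' + sizeD ρ) ≡ suc (sizeD π₁ + sizeD π₂)
  size≡ = cong suc (begin
    sizeD π' + sizeD ρ                     ≡⟨ cong (_+ sizeD ρ) |π'| ⟩
    suc (sizeD π₁' + sizeD w + sizeD ρ)    ≡⟨ cong suc (ℕ+.xy∙z≈xz∙y (sizeD π₁') _ _) ⟩
    suc (sizeD π₁' + sizeD ρ + sizeD w)    ≡⟨ cong₂ _+_ |π₁| |w| ⟩
    sizeD π₁ + sizeD π₂                    ∎)

_++ᴱ_ : ∀ {n k m} → Env k m → Env n k → Env n m
ε       ++ᴱ E = E
(j ∷ F) ++ᴱ E = j ∷ (F ++ᴱ E)

++ᴱ-identityʳ : ∀ {k m} (F : Env k m) → F ++ᴱ ε ≡ F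
++ᴱ-identityʳ ε       = refl
++ᴱ-identityʳ (j ∷ F) = cong (j ∷_) (++ᴱ-identityʳ F)

++ᴱ-∷ʳ : ∀ {n k m} (F : Env k m) (E : Env (suc n) k) (j : Inert n) → F ++ᴱ (E ∷ʳ j) ≡ (F ++ᴱ E) ∷ʳ j
++ᴱ-∷ʳ ε       E j = refl
++ᴱ-∷ʳ (i ∷ F) E j = cong (i ∷_) (++ᴱ-∷ʳ F E j)

record Reduct {n} (Γ : TCtx n) (q : Prog n) (N : MType) (k : ℕ) : Set where
  constructor reduct
  field
    {Γ'}  : TCtx n
    π'    : Γ' ⊢ₚ q ∶ N
    size≡ : suc (sizeDP π') ≡ k
    ctx≈  : Γ' ≈ᶜ Γ

Reduct-env-≡ : ∀ {n m} {Γ : TCtx n} {t : Tm m} {E E' N k} → E ≡ E' → Reduct Γ ⟨ t , E ⟩ N k → Reduct Γ ⟨ t , E' ⟩ N k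
Reduct-env-≡ refl r = r

⊢ₚ-under-env : ∀ {m m'} {t : Tm m} {t' : Tm m'} (F : Env m m') →
  (∀ {Γ N} (π : Γ ⊢ t ∶ N) → Reduct Γ ⟨ t' , F ⟩ N (sizeD π)) →
  ∀ {n} {E : Env n m} {Γ N} (π : Γ ⊢ₚ ⟨ t , E ⟩ ∶ N) → Reduct Γ ⟨ t' , F ++ᴱ E ⟩ N (sizeDP π)
⊢ₚ-under-env F base (esε π) = Reduct-env-≡ (≡.sym (++ᴱ-identityʳ F)) (base π)
⊢ₚ-under-env F base (es-snoc {E = E} jj π ρ) with ⊢ₚ-under-env F base π
... | reduct {M' ∷ Γ'} π' size≡ (M'≈ ∷ Γ'≈) =
  Reduct-env-≡ (≡.sym (++ᴱ-∷ʳ F E (_ , jj)))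
    (reduct (es-snoc jj π' (conv ρ (≈ₘ-sym M'≈))) (cong (_+ sizeD ρ) size≡) (⊎-cong Γ'≈ ≈ᶜ-refl))

subject-reduction : ∀ {n} {Γ : TCtx n} {p q N} (π : Γ ⊢ₚ p ∶ N) → p ⟶ q → Reduct Γ q N (sizeDP π)
subject-reduction π (βv C rC t isv E) = ⊢ₚ-under-env ε base π
  where
  base : ∀ {Γ N} (π : Γ ⊢ _ ∶ N) → Reduct Γ ⟨ _ , ε ⟩ N (sizeD π)
  base π with ⊢-βv rC isv π
  ... | _ , π' , size≡ , Γ'≈ = reduct (esε π') size≡ Γ'≈
subject-reduction π (βi C rC t ii E) = ⊢ₚ-under-env (_ ∷ ε) base π
  where
  base : ∀ {Γ N} (π : Γ ⊢ _ ∶ N) → Reduct Γ ⟨ _ , (_ , ii) ∷ ε ⟩ N (sizeD π)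
  base π with ⊢-βi rC π
  ... | es-reduct π' ρ size≡ Γ≈ = reduct (es-snoc ii (esε π') ρ) size≡ Γ≈

-- Tight derivations of normal programs

InertSizes : ∀ {n} → Tm n → Set
InertSizes {n} t = ∀ {Γ : TCtx n} {M} → InertCtx Γ → (π : Γ ⊢ t ∶ M) →
  InertM M × sizeD π + sizeM M ≡ sizeCtx Γ × size t ≡ sizeD π

TightSizes : ∀ {n} → Tm n → Set
TightSizes {n} t = ∀ {Γ : TCtx n} → InertCtx Γ → (π : Γ ⊢ t ∶ 𝟎) →
  sizeD π ≡ sizeCtx Γ × size t ≡ sizeD π

var-inertSizes : ∀ {n} {x : Fin n} → InertSizes (var x)
var-inertSizes {x = x} {M = M} iΓ π with var-inv π
... | M₀ , refl , M₀≈ , |π| =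
  InertM-resp-≈ₘ M₀≈ (InertCtx-single⁻ x iΓ) ,
  ≡.trans (cong₂ _+_ |π| (≡.sym (sizeM-resp-≈ₘ M₀≈))) (≡.sym (sizeCtx-single x M₀)) ,
  ≡.sym |π|

app-inertSizes : ∀ {n} {h f : Tm n} → InertSizes h → TightSizes f → InertSizes (app h f)
app-inertSizes {h = h} {f} h-sizes f-sizes {M = N} iΓ π with app-inv π
... | app-inversion {Γ₁} {Γ₂} {N₀ = N₀} π₁ π₂ refl N₀≈ |π| with InertCtx-⊎⁻ Γ₁ Γ₂ iΓ
... | iΓ₁ , iΓ₂ with h-sizes iΓ₁ π₁
... | iN₀ ∷ [] , |π₁|+|M| , |h| with f-sizes iΓ₂ π₂
... | |π₂| , |f| = InertM-resp-≈ₘ N₀≈ iN₀ , sizes , term-size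
  where
  open ≡-Reasoning
  sizes : sizeD π + sizeM N ≡ sizeCtx (Γ₁ ⊎ Γ₂)
  sizes = begin
    sizeD π + sizeM N                                 ≡⟨ cong₂ _+_ |π| (≡.sym (sizeM-resp-≈ₘ N₀≈)) ⟩
    suc (sizeD π₁ + sizeD π₂ + sizeM N₀)              ≡⟨ cong suc (ℕ+.xy∙z≈xz∙y (sizeD π₁) _ _) ⟩
    suc (sizeD π₁ + sizeM N₀) + sizeD π₂              ≡⟨ cong (_+ sizeD π₂) (≡.sym (+-suc (sizeD π₁) _)) ⟩
    sizeD π₁ + suc (sizeM N₀) + sizeD π₂              ≡⟨ cong (λ s → sizeD π₁ + s + sizeD π₂) (≡.sym (+-identityʳ _)) ⟩
    sizeD π₁ + sizeM ((𝟎 ⊸ N₀) ∷ []) + sizeD π₂       ≡⟨ cong₂ _+_ |π₁|+|M| |π₂| ⟩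
    sizeCtx Γ₁ + sizeCtx Γ₂                           ≡⟨ ≡.sym (sizeCtx-⊎ Γ₁ Γ₂) ⟩
    sizeCtx (Γ₁ ⊎ Γ₂)                                 ∎
  term-size : size h + size f + 1 ≡ sizeD π
  term-size = begin
    size h + size f + 1       ≡⟨ +-comm _ 1 ⟩
    suc (size h + size f)     ≡⟨ cong suc (cong₂ _+_ |h| |f|) ⟩
    suc (sizeD π₁ + sizeD π₂) ≡⟨ ≡.sym |π| ⟩
    sizeD π                   ∎

mutual
  inert-inertSizes : ∀ {n} {i : Tm n} → IsInert i → InertSizes i
  inert-inertSizes (varApp x ff) = app-inertSizes var-inertSizes (fireball-tightSizes ff)
  inert-inertSizes (inApp ii ff) = app-inertSizes (inert-inertSizes ii) (fireball-tightSizes ff)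

  fireball-tightSizes : ∀ {n} {f : Tm n} → IsFire f → TightSizes f
  fireball-tightSizes (val (var x)) iΓ π with var-inertSizes iΓ π
  ... | _ , |π|+0 , |f| = ≡.trans (≡.sym (+-identityʳ _)) |π|+0 , |f|
  fireball-tightSizes {n} (val (lam t)) iΓ π with val-𝟎 (lam t) π
  ... | refl , |π| = ≡.trans |π| (≡.sym (sizeCtx-empty n)) , ≡.sym |π|
  fireball-tightSizes (inert ii) iΓ π with inert-inertSizes ii iΓ π
  ... | _ , |π|+0 , |f| = ≡.trans (≡.sym (+-identityʳ _)) |π|+0 , |f|

sizeEnv-∷ʳ : ∀ {n m} (E : Env (suc n) m) (j : Inert n) → sizeEnv (E ∷ʳ j) ≡ sizeEnv E + size (proj₁ j)
sizeEnv-∷ʳ ε             (i , _) = +-identityʳ (size i)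
sizeEnv-∷ʳ ((i' , _) ∷ E) j      = ≡.trans (cong (size i' +_) (sizeEnv-∷ʳ E j)) (≡.sym (+-assoc (size i') _ _))

normal-tightSizes : ∀ {n m} {t : Tm m} {E : Env n m} {Γ : TCtx n} → IsFire t → InertCtx Γ →
  (π : Γ ⊢ₚ ⟨ t , E ⟩ ∶ 𝟎) → sizeDP π ≡ sizeP ⟨ t , E ⟩ × sizeDP π ≡ sizeCtx Γ
normal-tightSizes ft iΓ (esε π) with fireball-tightSizes ft iΓ π
... | |π| , |t| = ≡.trans (≡.sym |t|) (≡.sym (+-identityʳ _)) , |π|
normal-tightSizes {t = t} ft iΓ (es-snoc {Γ = Γ} {Δ} {M = M} {E = E} {i} ii π ρ) with InertCtx-⊎⁻ Γ Δ iΓ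
... | iΓ' , iΔ with inert-inertSizes ii iΔ ρ
... | iM , |ρ|+|M| , |i| with normal-tightSizes ft (iM ∷ iΓ') π
... | |π|≡|p| , |π|≡|Γ| = program-size , context-size
  where
  open ≡-Reasoning
  program-size : sizeDP π + sizeD ρ ≡ size t + sizeEnv (E ∷ʳ (i , ii))
  program-size = begin
    sizeDP π + sizeD ρ               ≡⟨ cong₂ _+_ |π|≡|p| (≡.sym |i|) ⟩
    size t + sizeEnv E + size i      ≡⟨ +-assoc (size t) _ _ ⟩
    size t + (sizeEnv E + size i)    ≡⟨ cong (size t +_) (≡.sym (sizeEnv-∷ʳ E (i , ii))) ⟩
    size t + sizeEnv (E ∷ʳ (i , ii)) ∎
  context-size : sizeDP π + sizeD ρ ≡ sizeCtx (Γ ⊎ Δ)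
  context-size = begin
    sizeDP π + sizeD ρ               ≡⟨ cong (_+ sizeD ρ) |π|≡|Γ| ⟩
    sizeM M + sizeCtx Γ + sizeD ρ    ≡⟨ ℕ+.xy∙z≈y∙zx (sizeM M) _ _ ⟩
    sizeCtx Γ + (sizeD ρ + sizeM M)  ≡⟨ cong (sizeCtx Γ +_) |ρ|+|M| ⟩
    sizeCtx Γ + sizeCtx Δ            ≡⟨ ≡.sym (sizeCtx-⊎ Γ Δ) ⟩
    sizeCtx (Γ ⊎ Δ)                  ∎

-- Progress and evaluation

data Redex {m} : Tm m → Set where
  redex : ∀ (C : ECtx m) → RightCtx C → ∀ s {f} → IsFire f → Redex (plug C (app (lam s) f))

progress : ∀ {m} (t : Tm m) → IsFire t ⊎′ Redex t
progress (var x) = inj₁ (val (var x))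
progress (lam s) = inj₁ (val (lam s))
progress (app u w) with progress w
... | inj₂ (redex C rC s ff) = inj₂ (redex (argCtx u C) (argCtx u rC) s ff)
... | inj₁ fw with progress u
...   | inj₂ (redex C rC s ff) = inj₂ (redex (funCtx C w) (funCtx rC fw) s ff)
...   | inj₁ (val (var x))     = inj₁ (inert (varApp x fw))
...   | inj₁ (val (lam s))     = inj₂ (redex hole hole s fw)
...   | inj₁ (inert iu)        = inj₁ (inert (inApp iu fw))

redex-step : ∀ {n m} {t : Tm m} → Redex t → (E : Env n m) → ∃ λ q → ⟨ t , E ⟩ ⟶ q
redex-step (redex C rC s (val isv))  E = _ , βv C rC s isv E
redex-step (redex C rC s (inert ii)) E = _ , βi C rC s ii E

mutual
  redex-not-fireball : ∀ {m} {C : ECtx m} {s u} → RightCtx C → ¬ IsFire (plug C (app (lam s) u))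
  redex-not-fireball rC             (inert ii) = redex-not-inert rC ii
  redex-not-fireball hole           (val ())
  redex-not-fireball (argCtx t rC)  (val ())
  redex-not-fireball (funCtx rC ff) (val ())

  redex-not-inert : ∀ {m} {C : ECtx m} {s u} → RightCtx C → ¬ IsInert (plug C (app (lam s) u))
  redex-not-inert hole           (inApp () _)
  redex-not-inert (argCtx t rC)  (varApp x ff) = redex-not-fireball rC ff
  redex-not-inert (argCtx t rC)  (inApp _ ff)  = redex-not-fireball rC ff
  -- A plugged redex is an application, not a variable, which shows only once C is split.
  redex-not-inert (funCtx hole ff)             (inApp ii _) = redex-not-inert hole ii
  redex-not-inert (funCtx (argCtx t rC) ff)    (inApp ii _) = redex-not-inert (argCtx t rC) ii
  redex-not-inert (funCtx (funCtx rC ff') ff)  (inApp ii _) = redex-not-inert (funCtx rC ff') ii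

fireball-normal : ∀ {n m} {t : Tm m} {E : Env n m} → IsFire t → Normal ⟨ t , E ⟩
fireball-normal ft _ (βv C rC s isv E) = redex-not-fireball rC ft
fireball-normal ft _ (βi C rC s ii E)  = redex-not-fireball rC ft

tight-evaluation : ∀ k {n} {p : Prog n} {Γ : TCtx n} (π : Γ ⊢ₚ p ∶ 𝟎) → InertCtx Γ → sizeDP π ≡ k →
  ∃ λ q → ∃ λ j → Σ (p ⟶*[ j ] q) λ d → Normal q × sizeDP π ≡ j + sizeP q × sizeDP π ≡ j + sizeCtx Γ
tight-evaluation k {p = ⟨ t , E ⟩} π iΓ |π| with progress t
... | inj₁ ft = ⟨ t , E ⟩ , 0 , done , fireball-normal ft , normal-tightSizes ft iΓ π
... | inj₂ r with redex-step r E
... | q , p⟶q with subject-reduction π p⟶q | k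
... | reduct π' size≡ Γ'≈ | zero with ≡.trans size≡ |π|
...   | ()
tight-evaluation k π iΓ |π| | inj₂ r | q , p⟶q | reduct π' size≡ Γ'≈ | suc k'
  with tight-evaluation k' π' (InertCtx-resp-≈ᶜ (≈ᶜ-sym Γ'≈) iΓ) (suc-injective (≡.trans size≡ |π|))
... | q' , j , d , normal , |π'|≡j+|q'| , |π'|≡j+|Γ'| =
  q' , suc j , step p⟶q d , normal ,
  ≡.trans (≡.sym size≡) (cong suc |π'|≡j+|q'|) ,
  ≡.trans (≡.sym size≡) (cong suc (≡.trans |π'|≡j+|Γ'| (cong (j +_) (sizeCtx-resp-≈ᶜ Γ'≈))))

inert-size≢0 : ∀ {m} {i : Tm m} → IsInert i → ¬ size i ≡ 0
inert-size≢0 (varApp x {f} _)  |i|≡0 with ≡.trans (+-comm 1 (size f)) |i|≡0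
... | ()
inert-size≢0 (inApp {i} {f} _ _) |i|≡0 with ≡.trans (+-comm 1 (size i + size f)) |i|≡0
... | ()

sizeP≡0⇒CoercedValue : ∀ {n} (q : Prog n) → sizeP q ≡ 0 → CoercedValue q
sizeP≡0⇒CoercedValue ⟨ var x , ε ⟩ _ = coerced (var x)
sizeP≡0⇒CoercedValue ⟨ lam t , ε ⟩ _ = coerced (lam t)
sizeP≡0⇒CoercedValue ⟨ app a b , E ⟩ |q|≡0 with ≡.trans (+-comm 1 (size a + size b)) (m+n≡0⇒m≡0 _ |q|≡0)
... | ()
sizeP≡0⇒CoercedValue ⟨ var x , (_ , ii) ∷ E ⟩ |q|≡0 = ⊥-elim (inert-size≢0 ii (m+n≡0⇒m≡0 _ |q|≡0))
sizeP≡0⇒CoercedValue ⟨ lam t , (_ , ii) ∷ E ⟩ |q|≡0 = ⊥-elim (inert-size≢0 ii (m+n≡0⇒m≡0 _ |q|≡0))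

theorem4 : ∀ {n} (p : Prog n) (Γ : TCtx n) (π : Γ ⊢ₚ p ∶ 𝟎) → Tight π →
    Σ (Prog n) λ q → Σ ℕ λ k → Σ (p ⟶*[ k ] q) λ d →
      Normal q × sizeDP π ≡ k + sizeP q × sizeDP π ≡ k + sizeCtx Γ
      × (EmptyDom Γ → sizeDP π ≡ k × CoercedValue q)
theorem4 p Γ π ((iΓ , _) , _) with tight-evaluation (sizeDP π) π iΓ refl
... | q , k , d , normal , |π|≡k+|q| , |π|≡k+|Γ| = q , k , d , normal , |π|≡k+|q| , |π|≡k+|Γ| , closed
  where
  closed : EmptyDom Γ → sizeDP π ≡ k × CoercedValue q
  closed 𝟎s = |π|≡k , sizeP≡0⇒CoercedValue q (+-cancelˡ-≡ k _ _ (≡.trans (≡.sym |π|≡k+|q|) |π|≡k+0))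
    where
    |π|≡k+0 : sizeDP π ≡ k + 0
    |π|≡k+0 = ≡.trans |π|≡k+|Γ| (cong (k +_) (sizeCtx-EmptyDom 𝟎s))
    |π|≡k : sizeDP π ≡ k
    |π|≡k = ≡.trans |π|≡k+0 (+-identityʳ k)
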